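{- Let $n$ and $k$ be nonnegative integers with $n\geq k$. Then $$\sum_{j=0}^{n-k}\binom{n-k}{j}(-1)^{n-k-j}B_{n-j}=\sum_{j=0}^{k}\binom{k}{j}(-1)^{k-j}\sum_{l=0}^{n-j}\binom{n-j}{l}(-1)^{l}B_{l},$$ where $B_m$ denotes the $m$-th Bernoulli number.
   Context: The Bernoulli numbers $B_m$ are defined by $\frac{t}{e^t-1}=\sum_{m\geq0}B_m\frac{t^m}{m!}$ (so $B_0=1$, $B_1=-\tfrac12$). Equivalently, for a fixed prime $p$, $B_m=\int_{\mathbb Z_p}x^m\,d\mu_1(x)$, where $\int_{\mathbb Z_p}f(x)\,d\mu_1(x)=\lim_{N\to\infty}p^{ -N}\sum_{x=0}^{p^N-1}f(x)$ is the bosonic $p$-adic (Volkenborn) integral on the $p$-adic integers $\mathbb Z_p$. -}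

module Defs where

open import Data.Nat as ℕ using (ℕ; zero; suc; _∸_)
open import Data.Nat.Combinatorics using (_C_)
open import Data.Integer as ℤ using (ℤ; +_)
open import Data.Rational as ℚ using (ℚ; 0ℚ; 1ℚ; _+_; _*_; -_; _/_)
open import Data.List using (List; []; _∷_; reverse; length; lookup)

sumTo : ℕ → (ℕ → ℚ) → ℚ
sumTo zero    f = f 0
sumTo (suc n) f = sumTo n f + f (suc n)

ℕ→ℚ : ℕ → ℚ
ℕ→ℚ n = (+ n) / 1

sgn : ℕ → ℚ
sgn zero    = 1ℚ
sgn (suc n) = - sgn n

-- Bernoulli numbers with B_1 = -1/2, i.e. t/(e^t - 1) = Σ B_m t^m/m!.
-- Equivalent to the recurrence B_0 = 1,
--   B_m = -(1/(m+1)) Σ_{k=0}^{m-1} C(m+1,k) B_k  (m ≥ 1),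
-- obtained by comparing coefficients in (e^t - 1) · t/(e^t-1) = t.
-- bernAll m is the list [B_m, B_{m-1}, …, B_0].
private
  idx : List ℚ → ℕ → ℚ
  idx []       _       = 0ℚ
  idx (x ∷ xs) zero    = x
  idx (x ∷ xs) (suc k) = idx xs k

bernAll : ℕ → List ℚ
bernAll zero    = 1ℚ ∷ []
bernAll (suc m) = next ∷ prev
  where
  prev : List ℚ
  prev = bernAll m
  B< : ℕ → ℚ
  B< k = idx prev (m ∸ k)
  next : ℚ
  next = - ((ℤ.+ 1 / suc (suc m)) * sumTo m (λ k → ℕ→ℚ (suc (suc m) C k) * B< k))

bernoulli : ℕ → ℚ
bernoulli m with bernAll m
... | []     = 0ℚ
... | x ∷ _  = x

{-# OPTIONS --safe #-}
-- Write Δᵐ f = Σₗ C(m,l) (-1)ˡ f(l) = ((1 - E)ᵐ f)(0), where E is the shift f ↦ f ∘ suc.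
-- Reflecting j ↦ n - k - j turns the left-hand side into Δⁿ⁻ᵏ (B ∘ (k +_)).  Reflecting
-- j ↦ k - j on the right-hand side gives Σⱼ C(k,j) (-1)ʲ Δⁿ⁻ᵏ⁺ʲ B, i.e. the operator
-- (1 - E)ⁿ⁻ᵏ (1 - (1 - E))ᵏ = (1 - E)ⁿ⁻ᵏ Eᵏ applied to B, which is the same number.
-- Nothing about B is used: the identity holds for every sequence of rationals.
module Submission where

open import Defs
open import Data.Nat using (ℕ; _≤_; _∸_)
open import Data.Nat.Combinatorics using (_C_)
open import Data.Rational using (_*_)
open import Relation.Binary.PropositionalEquality using (_≡_)

open import Function using (_∘_)
open import Data.Nat as ℕ using (zero; suc; z≤n)
import Data.Nat.Properties as ℕ
open import Data.Nat.Combinatorics using (nCk+nC[k+1]≡[n+1]C[k+1]; nCk≡nC[n∸k])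
open import Data.Nat.Combinatorics.Specification using (k>n⇒nCk≡0)
import Data.Integer as ℤ
import Data.Integer.Properties as ℤ
open import Data.Rational using (ℚ; mkℚ; _+_; _-_; -_; 0ℚ)
open import Data.Rational.Properties
open import Data.Rational.Solver using (module +-*-Solver)
import Data.Nat.Coprimality as Coprime
open import Algebra.Bundles using (module CommutativeMonoid)
open import Algebra.Properties.CommutativeSemigroup
  (CommutativeMonoid.commutativeSemigroup +-0-commutativeMonoid) using (interchange; x∙yz≈xz∙y)
open import Relation.Binary.PropositionalEquality
  using (refl; trans; sym; cong; cong₂; module ≡-Reasoning)
open ≡-Reasoning
open +-*-Solver using (solve; _:=_; _:-_)

fromℕ : ℕ → ℚ
fromℕ n = mkℚ (ℤ.+ n) 0 (Coprime.sym (Coprime.1-coprimeTo n))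

ℕ→ℚ≡fromℕ : ∀ n → ℕ→ℚ n ≡ fromℕ n
ℕ→ℚ≡fromℕ n = normalize-coprime (Coprime.sym (Coprime.1-coprimeTo n))

ℕ→ℚ-homo-+ : ∀ a b → ℕ→ℚ (a ℕ.+ b) ≡ ℕ→ℚ a + ℕ→ℚ b
-- fromℕ a + fromℕ b unfolds to (a * 1 + b * 1) / 1.
ℕ→ℚ-homo-+ a b = begin
  ℕ→ℚ (a ℕ.+ b)
    ≡⟨ /-cong (sym (cong₂ ℤ._+_ (ℤ.*-identityʳ (ℤ.+ a)) (ℤ.*-identityʳ (ℤ.+ b)))) refl ⟩
  fromℕ a + fromℕ b
    ≡⟨ cong₂ _+_ (ℕ→ℚ≡fromℕ a) (ℕ→ℚ≡fromℕ b) ⟨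
  ℕ→ℚ a + ℕ→ℚ b ∎

sumTo-cong : ∀ m {g h : ℕ → ℚ} → (∀ i → i ≤ m → g i ≡ h i) → sumTo m g ≡ sumTo m h
sumTo-cong zero    g≡h = g≡h 0 z≤n
sumTo-cong (suc m) g≡h =
  cong₂ _+_ (sumTo-cong m (λ i i≤m → g≡h i (ℕ.m≤n⇒m≤1+n i≤m))) (g≡h (suc m) ℕ.≤-refl)

sumTo-distrib-+ : ∀ m (g h : ℕ → ℚ) → sumTo m (λ i → g i + h i) ≡ sumTo m g + sumTo m h
sumTo-distrib-+ zero    g h = refl
sumTo-distrib-+ (suc m) g h = trans (cong (_+ (g (suc m) + h (suc m))) (sumTo-distrib-+ m g h))
  (interchange (sumTo m g) (sumTo m h) (g (suc m)) (h (suc m)))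

sumTo-neg : ∀ m (g : ℕ → ℚ) → sumTo m (λ i → - g i) ≡ - sumTo m g
sumTo-neg zero    g = refl
sumTo-neg (suc m) g = trans (cong (_- g (suc m)) (sumTo-neg m g))
  (sym (neg-distrib-+ (sumTo m g) (g (suc m))))

sumTo-sucˡ : ∀ m (g : ℕ → ℚ) → sumTo (suc m) g ≡ g 0 + sumTo m (g ∘ suc)
sumTo-sucˡ zero    g = refl
sumTo-sucˡ (suc m) g = trans (cong (_+ g (suc (suc m))) (sumTo-sucˡ m g))
  (+-assoc (g 0) (sumTo m (g ∘ suc)) _)

sumTo-reverse : ∀ m (g : ℕ → ℚ) → sumTo m g ≡ sumTo m (λ j → g (m ∸ j))
sumTo-reverse zero    g = refl
sumTo-reverse (suc m) g = begin
  sumTo m g + g (suc m)                 ≡⟨ cong (_+ g (suc m)) (sumTo-reverse m g) ⟩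
  sumTo m (λ j → g (m ∸ j)) + g (suc m) ≡⟨ +-comm _ (g (suc m)) ⟩
  g (suc m) + sumTo m (λ j → g (m ∸ j)) ≡⟨ sumTo-sucˡ m (λ j → g (suc m ∸ j)) ⟨
  sumTo (suc m) (λ j → g (suc m ∸ j))   ∎

binomialSum : ℕ → (ℕ → ℚ) → ℚ
binomialSum r g = sumTo r (λ i → ℕ→ℚ (r C i) * g i)

binomialSum-cong : ∀ r {g h : ℕ → ℚ} → (∀ i → i ≤ r → g i ≡ h i) →
                   binomialSum r g ≡ binomialSum r h
binomialSum-cong r g≡h = sumTo-cong r (λ i i≤r → cong (ℕ→ℚ (r C i) *_) (g≡h i i≤r))

binomialSum-neg : ∀ r (g : ℕ → ℚ) → binomialSum r (λ i → - g i) ≡ - binomialSum r g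
binomialSum-neg r g =
  trans (sumTo-cong r (λ i _ → sym (neg-distribʳ-* (ℕ→ℚ (r C i)) (g i)))) (sumTo-neg r _)

binomialSum-extend : ∀ r (g : ℕ → ℚ) →
                     sumTo (suc r) (λ i → ℕ→ℚ (r C i) * g i) ≡ binomialSum r g
binomialSum-extend r g = begin
  binomialSum r g + ℕ→ℚ (r C suc r) * g (suc r)
    ≡⟨ cong (λ c → binomialSum r g + ℕ→ℚ c * g (suc r)) (k>n⇒nCk≡0 (ℕ.n<1+n r)) ⟩
  binomialSum r g + 0ℚ * g (suc r)
    ≡⟨ cong (binomialSum r g +_) (*-zeroˡ (g (suc r))) ⟩
  binomialSum r g + 0ℚ
    ≡⟨ +-identityʳ _ ⟩
  binomialSum r g ∎

binomialSum-suc : ∀ r (g : ℕ → ℚ) →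
                  binomialSum (suc r) g ≡ binomialSum r g + binomialSum r (g ∘ suc)
binomialSum-suc r g = begin
  binomialSum (suc r) g
    ≡⟨ sumTo-sucˡ r _ ⟩
  g₀ + sumTo r (λ i → ℕ→ℚ (suc r C suc i) * g (suc i))
    ≡⟨ cong (g₀ +_) (trans (sumTo-cong r (λ i _ → pascal i)) (sumTo-distrib-+ r _ _)) ⟩
  g₀ + (binomialSum r (g ∘ suc) + S)
    ≡⟨ x∙yz≈xz∙y g₀ _ S ⟩
  (g₀ + S) + binomialSum r (g ∘ suc)
    ≡⟨ cong (_+ binomialSum r (g ∘ suc))
         (trans (sym (sumTo-sucˡ r (λ i → ℕ→ℚ (r C i) * g i))) (binomialSum-extend r g)) ⟩
  binomialSum r g + binomialSum r (g ∘ suc) ∎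
  where
  g₀ = ℕ→ℚ (r C 0) * g 0
  S  = sumTo r (λ i → ℕ→ℚ (r C suc i) * g (suc i))
  pascal : ∀ i → ℕ→ℚ (suc r C suc i) * g (suc i) ≡
                 ℕ→ℚ (r C i) * g (suc i) + ℕ→ℚ (r C suc i) * g (suc i)
  pascal i = begin
    ℕ→ℚ (suc r C suc i) * g (suc i)
      ≡⟨ cong (λ c → ℕ→ℚ c * g (suc i)) (nCk+nC[k+1]≡[n+1]C[k+1] r i) ⟨
    ℕ→ℚ (r C i ℕ.+ r C suc i) * g (suc i)
      ≡⟨ cong (_* g (suc i)) (ℕ→ℚ-homo-+ (r C i) (r C suc i)) ⟩
    (ℕ→ℚ (r C i) + ℕ→ℚ (r C suc i)) * g (suc i)
      ≡⟨ *-distribʳ-+ (g (suc i)) (ℕ→ℚ (r C i)) _ ⟩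
    ℕ→ℚ (r C i) * g (suc i) + ℕ→ℚ (r C suc i) * g (suc i) ∎

-- Δ r f is ((1 - E)ʳ f)(0) with E the shift, so the sign is opposite to the
-- usual forward difference (E - 1)ʳ when r is odd.
Δ : ℕ → (ℕ → ℚ) → ℚ
Δ zero    f = f 0
Δ (suc r) f = Δ r f - Δ r (f ∘ suc)

Δ-cong : ∀ r {f g : ℕ → ℚ} → (∀ i → f i ≡ g i) → Δ r f ≡ Δ r g
Δ-cong zero    f≡g = f≡g 0
Δ-cong (suc r) f≡g = cong₂ _-_ (Δ-cong r f≡g) (Δ-cong r (f≡g ∘ suc))

sgn-suc-* : ∀ i x → sgn (suc i) * x ≡ - (sgn i * x)
sgn-suc-* i x = sym (neg-distribˡ-* (sgn i) x)

binomialSum-sgn≡Δ : ∀ r (f : ℕ → ℚ) → binomialSum r (λ i → sgn i * f i) ≡ Δ r f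
binomialSum-sgn≡Δ zero    f = trans (*-identityˡ _) (*-identityˡ _)
binomialSum-sgn≡Δ (suc r) f = begin
  binomialSum (suc r) (λ i → sgn i * f i)
    ≡⟨ binomialSum-suc r _ ⟩
  binomialSum r (λ i → sgn i * f i) + binomialSum r (λ i → sgn (suc i) * f (suc i))
    ≡⟨ cong₂ _+_ (binomialSum-sgn≡Δ r f)
                 (binomialSum-cong r (λ i _ → sgn-suc-* i (f (suc i)))) ⟩
  Δ r f + binomialSum r (λ i → - (sgn i * f (suc i)))
    ≡⟨ cong (Δ r f +_) (trans (binomialSum-neg r _)
                              (cong -_ (binomialSum-sgn≡Δ r (f ∘ suc)))) ⟩
  Δ r f - Δ r (f ∘ suc) ∎

alternatingSum≡Δ : ∀ m (f : ℕ → ℚ) →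
                   sumTo m (λ l → ℕ→ℚ (m C l) * sgn l * f l) ≡ Δ m f
alternatingSum≡Δ m f = trans (sumTo-cong m (λ l _ → *-assoc (ℕ→ℚ (m C l)) (sgn l) (f l)))
                             (binomialSum-sgn≡Δ m f)

-- The operator identity (1 - E)ᵃ (1 - (1 - E))ᵏ = (1 - E)ᵃ Eᵏ, evaluated at 0.
binomialSum-sgn-Δ≡Δ-shift : ∀ k a (f : ℕ → ℚ) →
  binomialSum k (λ i → sgn i * Δ (a ℕ.+ i) f) ≡ Δ a (λ i → f (k ℕ.+ i))
binomialSum-sgn-Δ≡Δ-shift zero a f =
  trans (*-identityˡ _) (trans (*-identityˡ _) (cong (λ b → Δ b f) (ℕ.+-identityʳ a)))
binomialSum-sgn-Δ≡Δ-shift (suc k) a f = begin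
  binomialSum (suc k) (λ i → sgn i * Δ (a ℕ.+ i) f)
    ≡⟨ binomialSum-suc k _ ⟩
  binomialSum k (λ i → sgn i * Δ (a ℕ.+ i) f)
    + binomialSum k (λ i → sgn (suc i) * Δ (a ℕ.+ suc i) f)
    ≡⟨ cong₂ _+_ (binomialSum-sgn-Δ≡Δ-shift k a f)
                 (binomialSum-cong k (λ i _ → trans (sgn-suc-* i _)
                   (cong (λ b → - (sgn i * Δ b f)) (ℕ.+-suc a i)))) ⟩
  Δ a F + binomialSum k (λ i → - (sgn i * Δ (suc a ℕ.+ i) f))
    ≡⟨ cong (Δ a F +_) (trans (binomialSum-neg k _)
                              (cong -_ (binomialSum-sgn-Δ≡Δ-shift k (suc a) f))) ⟩
  Δ a F - (Δ a F - Δ a (F ∘ suc))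
    ≡⟨ solve 2 (λ x y → x :- (x :- y) := y) refl (Δ a F) (Δ a (F ∘ suc)) ⟩
  Δ a (λ i → f (k ℕ.+ suc i))
    ≡⟨ Δ-cong a (λ i → cong f (ℕ.+-suc k i)) ⟩
  Δ a (λ i → f (suc k ℕ.+ i)) ∎
  where F = λ i → f (k ℕ.+ i)

sumTo-reflect : ∀ m (g : ℕ → ℚ) →
  sumTo m (λ j → ℕ→ℚ (m C j) * sgn (m ∸ j) * g j) ≡ binomialSum m (λ j → sgn j * g (m ∸ j))
sumTo-reflect m g = trans (sumTo-reverse m _) (sumTo-cong m reflect)
  where
  reflect : ∀ j → j ≤ m →
    ℕ→ℚ (m C (m ∸ j)) * sgn (m ∸ (m ∸ j)) * g (m ∸ j) ≡ ℕ→ℚ (m C j) * (sgn j * g (m ∸ j))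
  reflect j j≤m = begin
    ℕ→ℚ (m C (m ∸ j)) * sgn (m ∸ (m ∸ j)) * g (m ∸ j)
      ≡⟨ cong₂ (λ c s → ℕ→ℚ c * sgn s * g (m ∸ j)) (nCk≡nC[n∸k] j≤m) (sym (ℕ.m∸[m∸n]≡n j≤m)) ⟨
    ℕ→ℚ (m C j) * sgn j * g (m ∸ j)
      ≡⟨ *-assoc (ℕ→ℚ (m C j)) (sgn j) _ ⟩
    ℕ→ℚ (m C j) * (sgn j * g (m ∸ j)) ∎

[a+b]∸[b∸j]≡a+j : ∀ a {b j} → j ≤ b → (a ℕ.+ b) ∸ (b ∸ j) ≡ a ℕ.+ j
[a+b]∸[b∸j]≡a+j a {b} {j} j≤b =
  trans (ℕ.+-∸-assoc a (ℕ.m∸n≤m b j)) (cong (a ℕ.+_) (ℕ.m∸[m∸n]≡n j≤b))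

mainTheorem1 : (n k : ℕ) → k ≤ n →
    sumTo (n ∸ k) (λ j → ℕ→ℚ ((n ∸ k) C j) * sgn (n ∸ k ∸ j) * bernoulli (n ∸ j))
    ≡ sumTo k (λ j → ℕ→ℚ (k C j) * sgn (k ∸ j)
    * sumTo (n ∸ j) (λ l → ℕ→ℚ ((n ∸ j) C l) * sgn l * bernoulli l))
mainTheorem1 n k k≤n = begin
  sumTo m (λ j → ℕ→ℚ (m C j) * sgn (m ∸ j) * B (n ∸ j))
    ≡⟨ sumTo-reflect m _ ⟩
  binomialSum m (λ j → sgn j * B (n ∸ (m ∸ j)))
    ≡⟨ binomialSum-cong m (λ j j≤m → cong (λ i → sgn j * B i)
         (trans (cong (_∸ (m ∸ j)) (sym (ℕ.m+[n∸m]≡n k≤n))) ([a+b]∸[b∸j]≡a+j k j≤m))) ⟩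
  binomialSum m (λ j → sgn j * B (k ℕ.+ j))
    ≡⟨ binomialSum-sgn≡Δ m _ ⟩
  Δ m (λ j → B (k ℕ.+ j))
    ≡⟨ binomialSum-sgn-Δ≡Δ-shift k m B ⟨
  binomialSum k (λ j → sgn j * Δ (m ℕ.+ j) B)
    ≡⟨ binomialSum-cong k (λ j j≤k → cong (λ i → sgn j * Δ i B)
         (trans (cong (_∸ (k ∸ j)) (sym (ℕ.m∸n+n≡m k≤n))) ([a+b]∸[b∸j]≡a+j m j≤k))) ⟨
  binomialSum k (λ j → sgn j * Δ (n ∸ (k ∸ j)) B)
    ≡⟨ sumTo-reflect k (λ j → Δ (n ∸ j) B) ⟨
  sumTo k (λ j → ℕ→ℚ (k C j) * sgn (k ∸ j) * Δ (n ∸ j) B)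
    ≡⟨ sumTo-cong k (λ j _ → cong (ℕ→ℚ (k C j) * sgn (k ∸ j) *_) (alternatingSum≡Δ (n ∸ j) B)) ⟨
  sumTo k (λ j → ℕ→ℚ (k C j) * sgn (k ∸ j)
    * sumTo (n ∸ j) (λ l → ℕ→ℚ ((n ∸ j) C l) * sgn l * B l)) ∎
  where
  m = n ∸ k
  B = bernoulli
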